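{- Let $(G,+)$ be a group (not necessarily commutative) and let $I[1],\dots,I[N]$ ($N\ge 1$) be elements of $G$. Let $A$ be the array obtained from $I$ by the Southwest Tree build procedure described in the context. Then for every index $1\le i\le N$, $$A[i] = I[i-2^{h_i}+2] + I[i-2^{h_i}+3] + \cdots + I[i],$$ where $h_i$ is the height of the node with index $i$ in the Southwest Tree, and the operands are combined in increasing order of index.
   Context: Southwest Tree index structure: let $h_r=\lfloor \log_2 N\rfloor+1$. Define a full binary tree whose nodes are labelled by indices as follows: the root has index $2^{h_r}-1$ and height $h_r$; a node with index $i$ and height $h>1$ has left child with index $i-2^{h-1}$ and right child with index $i-1$, both of height $h-1$; nodes of height $1$ are leaves. Every index in $\{1,\dots,2^{h_r}-1\}$ occurs as exactly one node, and $h_i$ denotes the height of the node with index $i$. Indices greater than $N$ are "phantom" nodes: they are used only for traversal and store no value. Build procedure: initially $A[j]=I[j]$ for $1\le j\le N$ ($A$ overwrites $I$ in place). The tree is traversed depth-first in post-order (left subtree, then right subtree, then the node); when visiting a node of index $i\le N$ with height $h>1$, set $A[i] := A[i-2^{h-1}] + A[i-1] + A[i]$ (operands in this order); phantom nodes ($i>N$) and leaves are left unchanged. The operation $+$ is written additively but may be non-commutative; sums are always taken in the stated order. -}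

module Defs where

open import Level using (Level)
open import Algebra.Bundles using (Group)
open import Data.Nat using (ℕ; zero; suc; _+_; _∸_; _^_; _≤?_; _≡ᵇ_)
open import Data.Nat.Logarithm using (⌊log₂_⌋)
open import Data.Bool using (if_then_else_)
open import Relation.Nullary.Decidable using (does)

rootHeight : ℕ → ℕ
rootHeight N = ⌊log₂ N ⌋ + 1

rootIndex : ℕ → ℕ
rootIndex N = 2 ^ rootHeight N ∸ 1

-- Node h r i k : in the Southwest (sub)tree whose root has height h and
-- index r, the node with index i has height k.
data Node : (h r i k : ℕ) → Set where
  here  : ∀ {h r} → Node (suc h) r r (suc h)
  left  : ∀ {h r i k} → Node (suc h) (r ∸ 2 ^ suc h) i k → Node (suc (suc h)) r i k
  right : ∀ {h r i k} → Node (suc h) (r ∸ 1) i k → Node (suc (suc h)) r i k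

HeightOf : (N i k : ℕ) → Set
HeightOf N i k = Node (rootHeight N) (rootIndex N) i k

module _ {c ℓ : Level} (G : Group c ℓ) where
  open Group G

  -- arrays are modelled as functions ℕ → Carrier (1-based; only indices
  -- 1..N are ever read or written by the build procedure)
  update : (ℕ → Carrier) → ℕ → Carrier → (ℕ → Carrier)
  update A i v j = if j ≡ᵇ i then v else A j

  visit : (N h i : ℕ) → (ℕ → Carrier) → (ℕ → Carrier)
  visit N zero i A = A
  visit N (suc zero) i A = A
  visit N (suc (suc h)) i A =
    let A₁ = visit N (suc h) (i ∸ 2 ^ suc h) A
        A₂ = visit N (suc h) (i ∸ 1) A₁
    in if does (i ≤? N)
         then update A₂ i ((A₂ (i ∸ 2 ^ suc h) ∙ A₂ (i ∸ 1)) ∙ A₂ i)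
         else A₂

  build : (N : ℕ) → (ℕ → Carrier) → (ℕ → Carrier)
  build N I = visit N (rootHeight N) (rootIndex N) I

  rangeSum : (ℕ → Carrier) → ℕ → ℕ → Carrier
  rangeSum I a zero = ε
  rangeSum I a (suc n) = I a ∙ rangeSum I (suc a) n

{-# OPTIONS --safe #-}
module Submission where

-- The subtree of height h whose root has index r = b + (2^h − 1) occupies exactly the
-- indices b + 1, …, r: its left subtree the lower half, its right subtree the upper
-- half except r, and r itself last. Visiting a subtree writes only inside its own
-- range, so the left visit leaves the inputs of the right half intact and the right
-- visit leaves the results of the left half intact. By induction on the height, when
-- the root is visited its children hold the sums of the two halves, and the root
-- receives the sum of its whole range in increasing order.

open import Defs
open import Level using (Level; _⊔_)
open import Algebra.Bundles using (Group)
open import Data.Nat using (ℕ; zero; suc; _+_; _∸_; _^_; _≤_; _<_; _≤?_; _≟_)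
open import Data.Nat.Properties
open import Data.Bool using (true; false)
open import Data.Sum using (_⊎_; inj₁; inj₂)
open import Relation.Nullary using (does)
open import Relation.Nullary.Decidable using (dec-true; dec-false)
open import Relation.Binary.PropositionalEquality
  using (_≡_; _≢_; refl; sym; trans; cong; cong₂; subst; module ≡-Reasoning)
import Relation.Binary.Reasoning.Setoid as SetoidReasoning

treeSize : ℕ → ℕ
treeSize h = 2 ^ h ∸ 1

2^≡suc-treeSize : ∀ h → 2 ^ h ≡ suc (treeSize h)
2^≡suc-treeSize h = sym (suc-pred (2 ^ h) {{m^n≢0 2 h}})

treeSize-suc : ∀ h → treeSize (suc h) ≡ suc (treeSize h + treeSize h)
treeSize-suc h = begin
  2 ^ h + (2 ^ h + 0) ∸ 1 ≡⟨ cong (λ x → x + (x + 0) ∸ 1) (2^≡suc-treeSize h) ⟩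
  s + (suc s + 0)         ≡⟨ cong (s +_) (+-identityʳ (suc s)) ⟩
  s + suc s               ≡⟨ +-suc s s ⟩
  suc (s + s)             ∎
  where
  s : ℕ
  s = treeSize h
  open ≡-Reasoning

record Spans (h b r : ℕ) : Set where
  constructor spans
  field
    root≡ : r ≡ b + treeSize h

Spans-rangeStart : ∀ {h b r} → Spans h b r → r + 2 ∸ 2 ^ h ≡ suc b
Spans-rangeStart {h} {b} {r} (spans r≡) = begin
  r + 2 ∸ 2 ^ h           ≡⟨ cong₂ (λ x y → x + 2 ∸ y) r≡ (2^≡suc-treeSize h) ⟩
  b + t + 2 ∸ suc t       ≡⟨ cong (_∸ suc t) (+-comm (b + t) 2) ⟩
  suc b + t ∸ t           ≡⟨ m+n∸n≡m (suc b) t ⟩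
  suc b                   ∎
  where
  t : ℕ
  t = treeSize h
  open ≡-Reasoning

module _ {h b r : ℕ} (sp : Spans (suc (suc h)) b r) where
  private
    s : ℕ
    s = treeSize (suc h)

  root≡suc : r ≡ suc (b + s + s)
  root≡suc = begin
    r                          ≡⟨ Spans.root≡ sp ⟩
    b + treeSize (suc (suc h)) ≡⟨ cong (b +_) (treeSize-suc (suc h)) ⟩
    b + suc (s + s)            ≡⟨ +-suc b (s + s) ⟩
    suc (b + (s + s))          ≡⟨ cong suc (+-assoc b s s) ⟨
    suc (b + s + s)            ∎
    where open ≡-Reasoning

  leftRoot≡ : r ∸ 2 ^ suc h ≡ b + s
  leftRoot≡ = trans (cong₂ _∸_ root≡suc (2^≡suc-treeSize (suc h))) (m+n∸n≡m (b + s) s)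

  Spans-left : Spans (suc h) b (r ∸ 2 ^ suc h)
  Spans-left = spans leftRoot≡

  Spans-right : Spans (suc h) (b + s) (r ∸ 1)
  Spans-right = spans (cong (_∸ 1) root≡suc)

  rightRoot<root : r ∸ 1 < r
  rightRoot<root = subst (λ x → x ∸ 1 < x) (sym root≡suc) ≤-refl

  leftRoot<root : r ∸ 2 ^ suc h < r
  leftRoot<root = ≤-<-trans (∸-monoʳ-≤ r (m^n>0 2 (suc h))) rightRoot<root

  base<root : b < r
  base<root = ≤-<-trans (≤-trans (m≤m+n b s) (≤-reflexive (sym leftRoot≡))) leftRoot<root

Node-≤root : ∀ {h r j k} → Node h r j k → j ≤ r
Node-≤root here = ≤-refl
Node-≤root {r = r} (left {h = h} n) = ≤-trans (Node-≤root n) (m∸n≤m r (2 ^ suc h))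
Node-≤root {r = r} (right n) = ≤-trans (Node-≤root n) (m∸n≤m r 1)

Node-rangeStart : ∀ {h b r j k} → Spans h b r → Node h r j k → b < j + 2 ∸ 2 ^ k
Node-rangeStart sp here = ≤-reflexive (sym (Spans-rangeStart sp))
Node-rangeStart sp (left n) = Node-rangeStart (Spans-left sp) n
Node-rangeStart {b = b} sp (right {h = h} n) =
  ≤-<-trans (m≤m+n b (treeSize (suc h))) (Node-rangeStart (Spans-right sp) n)

outside-shrink : ∀ {b r b′ r′ j} → b ≤ b′ → r′ ≤ r → j ≤ b ⊎ r < j → j ≤ b′ ⊎ r′ < j
outside-shrink b≤b′ r′≤r (inj₁ j≤b) = inj₁ (≤-trans j≤b b≤b′)
outside-shrink b≤b′ r′≤r (inj₂ r<j) = inj₂ (≤-<-trans r′≤r r<j)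

outside⇒≢ : ∀ {b r j} → b < r → j ≤ b ⊎ r < j → j ≢ r
outside⇒≢ b<r (inj₁ j≤b) = <⇒≢ (≤-<-trans j≤b b<r)
outside⇒≢ b<r (inj₂ r<j) j≡r = <⇒≢ r<j (sym j≡r)

module _ {c ℓ : Level} (G : Group c ℓ) where
  open Group G using (Carrier; _≈_; _∙_; ε; setoid; reflexive; identityˡ; identityʳ; assoc; ∙-cong; ∙-congˡ)
  open SetoidReasoning setoid

  update-≢ : ∀ (A : ℕ → Carrier) {i j} v → j ≢ i → update G A i v j ≡ A j
  update-≢ A {i} {j} v j≢i rewrite dec-false (j ≟ i) j≢i = refl

  update-≡ : ∀ (A : ℕ → Carrier) i v → update G A i v i ≡ v
  update-≡ A i v rewrite dec-true (i ≟ i) refl = refl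

  rangeSum-cong : ∀ {f g : ℕ → Carrier} a n → (∀ m → a ≤ m → f m ≡ g m) → rangeSum G f a n ≡ rangeSum G g a n
  rangeSum-cong a zero f≗g = refl
  rangeSum-cong a (suc n) f≗g =
    cong₂ _∙_ (f≗g a ≤-refl) (rangeSum-cong (suc a) n (λ m a<m → f≗g m (<⇒≤ a<m)))

  rangeSum-+ : ∀ (A : ℕ → Carrier) a m n → rangeSum G A a (m + n) ≈ rangeSum G A a m ∙ rangeSum G A (a + m) n
  rangeSum-+ A a zero n = begin
    rangeSum G A a n       ≡⟨ cong (λ x → rangeSum G A x n) (+-identityʳ a) ⟨
    rangeSum G A (a + 0) n ≈⟨ identityˡ _ ⟨
    ε ∙ rangeSum G A (a + 0) n ∎
  rangeSum-+ A a (suc m) n = begin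
    A a ∙ rangeSum G A (suc a) (m + n)                           ≈⟨ ∙-congˡ (rangeSum-+ A (suc a) m n) ⟩
    A a ∙ (rangeSum G A (suc a) m ∙ rangeSum G A (suc a + m) n)  ≈⟨ assoc _ _ _ ⟨
    (A a ∙ rangeSum G A (suc a) m) ∙ rangeSum G A (suc a + m) n  ≡⟨ cong (λ x → (A a ∙ rangeSum G A (suc a) m) ∙ rangeSum G A x n) (+-suc a m) ⟨
    (A a ∙ rangeSum G A (suc a) m) ∙ rangeSum G A (a + suc m) n  ∎

  rangeSum-halves : ∀ (A : ℕ → Carrier) a s →
                    (rangeSum G A a s ∙ rangeSum G A (a + s) s) ∙ A (a + s + s) ≈ rangeSum G A a (suc (s + s))
  rangeSum-halves A a s = begin
    (rangeSum G A a s ∙ rangeSum G A (a + s) s) ∙ A (a + s + s)   ≡⟨ cong (λ x → (rangeSum G A a s ∙ rangeSum G A (a + s) s) ∙ A x) (+-assoc a s s) ⟩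
    (rangeSum G A a s ∙ rangeSum G A (a + s) s) ∙ A (a + (s + s)) ≈⟨ ∙-cong (rangeSum-+ A a s s) (identityʳ _) ⟨
    rangeSum G A a (s + s) ∙ rangeSum G A (a + (s + s)) 1         ≈⟨ rangeSum-+ A a (s + s) 1 ⟨
    rangeSum G A a (s + s + 1)                                    ≡⟨ cong (rangeSum G A a) (+-comm (s + s) 1) ⟩
    rangeSum G A a (suc (s + s))                                  ∎

  module _ (N : ℕ) where
    visitChildren : ℕ → ℕ → (ℕ → Carrier) → ℕ → Carrier
    visitChildren h r A = visit G N (suc h) (r ∸ 1) (visit G N (suc h) (r ∸ 2 ^ suc h) A)

    visit-≢root : ∀ h {r j} A → j ≢ r → visit G N (suc (suc h)) r A j ≡ visitChildren h r A j
    visit-≢root h {r} A j≢r with does (r ≤? N)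
    ... | true  = update-≢ (visitChildren h r A) _ j≢r
    ... | false = refl

    visit-root : ∀ h {r} A → r ≤ N → visit G N (suc (suc h)) r A r ≡
                 (visitChildren h r A (r ∸ 2 ^ suc h) ∙ visitChildren h r A (r ∸ 1)) ∙ visitChildren h r A r
    visit-root h {r} A r≤N rewrite dec-true (r ≤? N) r≤N = update-≡ (visitChildren h r A) r _

    visit-outside : ∀ h {b r j} A → Spans h b r → j ≤ b ⊎ r < j → visit G N h r A j ≡ A j
    visit-outside zero          A sp out = refl
    visit-outside (suc zero)    A sp out = refl
    visit-outside (suc (suc h)) {b} {r} A sp out =
      trans (visit-≢root h A (outside⇒≢ (base<root sp) out))
      (trans (visit-outside (suc h) A₁ (Spans-right sp) (outside-shrink (m≤m+n b _) (m∸n≤m r 1) out))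
             (visit-outside (suc h) A (Spans-left sp) (outside-shrink ≤-refl (m∸n≤m r (2 ^ suc h)) out)))
      where
      A₁ : ℕ → Carrier
      A₁ = visit G N (suc h) (r ∸ 2 ^ suc h) A

    VisitSums : ℕ → Set (c ⊔ ℓ)
    VisitSums h = ∀ {b r j k} A → Spans h b r → Node h r j k → j ≤ N →
                  visit G N h r A j ≈ rangeSum G A (j + 2 ∸ 2 ^ k) (treeSize k)

    visitChildren-left : ∀ {h b r j k} A → VisitSums (suc h) → Spans (suc (suc h)) b r →
                         Node (suc h) (r ∸ 2 ^ suc h) j k → j ≤ N →
                         visitChildren h r A j ≈ rangeSum G A (j + 2 ∸ 2 ^ k) (treeSize k)
    visitChildren-left {h} {b} {r} {j} A ih sp n j≤N = begin
      visitChildren h r A j ≡⟨ visit-outside (suc h) A₁ (Spans-right sp) (inj₁ j≤leftRoot) ⟩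
      A₁ j                  ≈⟨ ih A (Spans-left sp) n j≤N ⟩
      _                     ∎
      where
      A₁ : ℕ → Carrier
      A₁ = visit G N (suc h) (r ∸ 2 ^ suc h) A
      j≤leftRoot : j ≤ b + treeSize (suc h)
      j≤leftRoot = ≤-trans (Node-≤root n) (≤-reflexive (leftRoot≡ sp))

    visitChildren-right : ∀ {h b r j k} A → VisitSums (suc h) → Spans (suc (suc h)) b r →
                          Node (suc h) (r ∸ 1) j k → j ≤ N →
                          visitChildren h r A j ≈ rangeSum G A (j + 2 ∸ 2 ^ k) (treeSize k)
    visitChildren-right {h} {r = r} {j} {k} A ih sp n j≤N = begin
      visitChildren h r A j                      ≈⟨ ih A₁ (Spans-right sp) n j≤N ⟩
      rangeSum G A₁ (j + 2 ∸ 2 ^ k) (treeSize k) ≡⟨ rangeSum-cong _ (treeSize k) A₁≗A ⟩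
      rangeSum G A  (j + 2 ∸ 2 ^ k) (treeSize k) ∎
      where
      A₁ : ℕ → Carrier
      A₁ = visit G N (suc h) (r ∸ 2 ^ suc h) A
      leftRoot<start : r ∸ 2 ^ suc h < j + 2 ∸ 2 ^ k
      leftRoot<start = subst (_< j + 2 ∸ 2 ^ k) (sym (leftRoot≡ sp)) (Node-rangeStart (Spans-right sp) n)
      A₁≗A : ∀ m → j + 2 ∸ 2 ^ k ≤ m → A₁ m ≡ A m
      A₁≗A m start≤m = visit-outside (suc h) A (Spans-left sp) (inj₂ (<-≤-trans leftRoot<start start≤m))

    visitChildren-root : ∀ {h b r} A → Spans (suc (suc h)) b r → visitChildren h r A r ≡ A r
    visitChildren-root {h} {r = r} A sp =
      trans (visit-outside (suc h) (visit G N (suc h) (r ∸ 2 ^ suc h) A) (Spans-right sp) (inj₂ (rightRoot<root sp)))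
            (visit-outside (suc h) A (Spans-left sp) (inj₂ (leftRoot<root sp)))

    visitSums-suc : ∀ h → VisitSums (suc h) → VisitSums (suc (suc h))
    visitSums-suc h ih {r = r} A sp (left n) j≤N = begin
      visit G N (suc (suc h)) r A _ ≡⟨ visit-≢root h A (<⇒≢ (≤-<-trans (Node-≤root n) (leftRoot<root sp))) ⟩
      visitChildren h r A _         ≈⟨ visitChildren-left A ih sp n j≤N ⟩
      _                             ∎
    visitSums-suc h ih {r = r} A sp (right n) j≤N = begin
      visit G N (suc (suc h)) r A _ ≡⟨ visit-≢root h A (<⇒≢ (≤-<-trans (Node-≤root n) (rightRoot<root sp))) ⟩
      visitChildren h r A _         ≈⟨ visitChildren-right A ih sp n j≤N ⟩
      _                             ∎
    visitSums-suc h ih {b} {r} A sp here r≤N = begin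
      visit G N (suc (suc h)) r A r                           ≡⟨ visit-root h A r≤N ⟩
      (C (r ∸ 2 ^ suc h) ∙ C (r ∸ 1)) ∙ C r
        ≈⟨ ∙-cong (∙-cong (visitChildren-left A ih sp here (≤-trans (m∸n≤m r (2 ^ suc h)) r≤N))
                          (visitChildren-right A ih sp here (≤-trans (m∸n≤m r 1) r≤N)))
                  (reflexive (visitChildren-root A sp)) ⟩
      (rangeSum G A (r ∸ 2 ^ suc h + 2 ∸ 2 ^ suc h) s ∙ rangeSum G A (r ∸ 1 + 2 ∸ 2 ^ suc h) s) ∙ A r
        ≈⟨ ∙-cong (∙-cong (reflexive (cong (λ x → rangeSum G A x s) (Spans-rangeStart (Spans-left sp))))
                          (reflexive (cong (λ x → rangeSum G A x s) (Spans-rangeStart (Spans-right sp)))))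
                  (reflexive (cong A (root≡suc sp))) ⟩
      (rangeSum G A (suc b) s ∙ rangeSum G A (suc b + s) s) ∙ A (suc b + s + s) ≈⟨ rangeSum-halves A (suc b) s ⟩
      rangeSum G A (suc b) (suc (s + s))
        ≡⟨ cong₂ (rangeSum G A) (Spans-rangeStart sp) (treeSize-suc (suc h)) ⟨
      rangeSum G A (r + 2 ∸ 2 ^ suc (suc h)) (treeSize (suc (suc h))) ∎
      where
      s : ℕ
      s = treeSize (suc h)
      C : ℕ → Carrier
      C = visitChildren h r A

    visitSums : ∀ h → VisitSums h
    visitSums zero A sp ()
    visitSums (suc zero) {r = r} A sp here r≤N = begin
      A r               ≡⟨ cong A (m+n∸n≡m r 2) ⟨
      A (r + 2 ∸ 2)     ≈⟨ identityʳ _ ⟨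
      A (r + 2 ∸ 2) ∙ ε ∎
    visitSums (suc (suc h)) = visitSums-suc h (visitSums (suc h))

lemma1 : ∀ {c ℓ : Level} (G : Group c ℓ) (N : ℕ) → 1 ≤ N →
           (I : ℕ → Group.Carrier G) →
           ∀ (i k : ℕ) → 1 ≤ i → i ≤ N → HeightOf N i k →
           Group._≈_ G (build G N I i) (rangeSum G I ((i + 2) ∸ 2 ^ k) (2 ^ k ∸ 1))
lemma1 G N _ I i k _ i≤N node = visitSums G N (rootHeight N) I (spans refl) node i≤N
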